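{- Let $k$ be a positive integer and $l\geq 2$ an integer, and let $B_{k+1}(x)$ be the $(k+1)$-th Bernoulli polynomial. Then the polynomial $$G(x)=\frac{B_{k+1}(lx+1)-B_{k+1}(x+1)}{k+1}\in\mathbb{Q}[x]$$ has at least two distinct (complex) zeroes.
   Context: The Bernoulli numbers $B_i$ are defined by $\frac{t}{e^t-1}=\sum_{i\ge 0}B_i\frac{t^i}{i!}$ (so $B_0=1$, $B_1=-\tfrac12$, $B_2=\tfrac16$), and the $q$-th Bernoulli polynomial is $B_{q}(x)=\sum_{i=0}^{q}\binom{q}{i}B_{i}x^{q-i}=x^{q}-\tfrac12 qx^{q-1}+\tfrac16\binom{q}{2}x^{q-2}+\cdots$. -}

module Defs where

open import Level using (Level; _⊔_; suc)
open import Data.Nat as ℕ using (ℕ; zero; _∸_; _≤_)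
  renaming (suc to sucℕ)
open import Data.Nat.Combinatorics using (_C_)
open import Data.Integer as ℤ using (+_)
open import Data.Rational as ℚ using (ℚ; 0ℚ; 1ℚ)
open import Data.List using (List; []; _∷_; _++_; foldr; upTo; length; zip; map)
open import Data.Product using (Σ; _×_; _,_; proj₁; proj₂)
open import Relation.Nullary using (¬_)
open import Relation.Binary.PropositionalEquality using (_≡_)
open import Algebra.Bundles using (CommutativeRing)

-- Bernoulli numbers (convention B₁ = -1/2), via the standard recursion
--   B₀ = 1,   B_m = -(1/(m+1)) Σ_{i<m} C(m+1,i) B_i   (m ≥ 1),
-- which is equivalent to t/(eᵗ-1) = Σ B_i tⁱ/i!.

ℕtoℚ : ℕ → ℚ
ℕtoℚ n = (+ n) ℚ./ 1

sumℚ : List ℚ → ℚ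
sumℚ = foldr ℚ._+_ 0ℚ

nextB : ℕ → List ℚ → ℚ
nextB m prev =
  ℚ.- (((+ 1) ℚ./ (sucℕ m)) ℚ.*
       sumℚ (map (λ p → ℕtoℚ (sucℕ m C proj₁ p) ℚ.* proj₂ p)
                 (zip (upTo m) prev)))

bernoulliList : ℕ → List ℚ
bernoulliList zero     = 1ℚ ∷ []
bernoulliList (sucℕ n) = bernoulliList n ++ (nextB (sucℕ n) (bernoulliList n) ∷ [])

lastℚ : List ℚ → ℚ
lastℚ []           = 0ℚ
lastℚ (x ∷ [])     = x
lastℚ (_ ∷ y ∷ ys) = lastℚ (y ∷ ys)

bernoulli : ℕ → ℚ
bernoulli n = lastℚ (bernoulliList n)

-- Algebraically closed fields containing ℚ (ℂ is one; the number of
-- distinct roots of a rational polynomial is the same in every such field).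

module Poly {c ℓ : Level} (R : CommutativeRing c ℓ) where
  open CommutativeRing R

  pow : Carrier → ℕ → Carrier
  pow x zero     = 1#
  pow x (sucℕ n) = x * pow x n

  evalList : List Carrier → Carrier → Carrier
  evalList []       x = 0#
  evalList (a ∷ as) x = a + x * evalList as x

record AlgClosedFieldOverℚ (c ℓ : Level) : Set (suc (c ⊔ ℓ)) where
  field
    K-ring : CommutativeRing c ℓ
  open CommutativeRing K-ring
  open Poly K-ring
  field
    1≉0     : ¬ (1# ≈ 0#)
    inverse : ∀ x → ¬ (x ≈ 0#) → Σ Carrier λ y → x * y ≈ 1#
    -- a ring homomorphism ℚ → K (forcing characteristic 0)
    ι       : ℚ → Carrier
    ι-+     : ∀ p q → ι (p ℚ.+ q) ≈ ι p + ι q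
    ι-*     : ∀ p q → ι (p ℚ.* q) ≈ ι p * ι q
    ι-1     : ι 1ℚ ≈ 1#
    closed  : ∀ (as : List Carrier) (a : Carrier) → 1 ≤ length as →
              ¬ (a ≈ 0#) → Σ Carrier λ x → evalList (as ++ (a ∷ [])) x ≈ 0#

  sumK : ℕ → (ℕ → Carrier) → Carrier
  sumK n f = foldr (λ i s → f i + s) 0# (upTo n)

  bernoulliPoly : ℕ → Carrier → Carrier
  bernoulliPoly q t =
    sumK (sucℕ q) (λ i → ι (ℕtoℚ (q C i) ℚ.* bernoulli i) * pow t (q ∸ i))

  G : ℕ → ℕ → Carrier → Carrier
  G k l x =
    ι ((+ 1) ℚ./ (sucℕ k)) *
      (bernoulliPoly (sucℕ k) (ι (ℕtoℚ l) * x + 1#)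
       - bernoulliPoly (sucℕ k) (x + 1#))

{-# OPTIONS --safe #-}
-- Write n = k + 1 ≥ 2 and H(x) = B_n(l x + 1) - B_n(x + 1), so that G = H / n.
-- Then H(0) = 0.  Since B_n(t) = tⁿ - (n/2) tⁿ⁻¹ + …, the two top
-- coefficients of H are (lⁿ - 1) at xⁿ and (n/2)(lⁿ⁻¹ - 1) at xⁿ⁻¹, both
-- nonzero because l ≥ 2.  So H = xʲ h(x) with h(0) ≠ 0 and deg h ≥ 1, and a
-- root of h in the algebraically closed field is a second, nonzero, root of G.
module Submission where

open import Defs
open import Level using (Level)
open import Data.Nat as ℕ using (ℕ; _≤_; zero; suc; s≤s; z≤n; _∸_)
open import Data.Product using (Σ; _×_; _,_; proj₁; proj₂)
open import Relation.Nullary using (¬_; yes; no)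
open import Algebra.Bundles using (CommutativeRing)

open import Function using (_∘_)
import Data.Nat.Properties as ℕₚ
open import Data.Nat.Combinatorics using (_C_; nC1≡n)
open import Data.Integer as ℤ using (+_)
import Data.Integer.Properties as ℤₚ
open import Data.Rational as Q using (ℚ; 0ℚ; 1ℚ; ½)
import Data.Rational.Properties as Qₚ
import Data.Rational.Unnormalised as Qᵘ
import Data.Rational.Unnormalised.Properties as Qᵘₚ
open import Data.Rational.Solver using (module +-*-Solver)
open import Data.List using (List; []; _∷_; _++_; length; map; foldr; applyUpTo)
import Data.List.Properties as List
open import Data.Sum using (inj₁; inj₂)
open import Data.Maybe using (nothing)
import Relation.Binary.PropositionalEquality as ≡
open ≡ using (_≡_; _≢_)

module RationalPolynomials where
  open Q using (_+_; _*_; -_)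
  open ≡ using (refl; sym; trans; cong; cong₂; subst)
  open ≡.≡-Reasoning
  open +-*-Solver
  open import Algebra.Properties.Group Qₚ.+-0-group using (x∙y⁻¹≈ε⇒x≈y)

  toℚᵘ-ℕtoℚ : ∀ n → Q.toℚᵘ (ℕtoℚ n) Qᵘ.≃ Qᵘ.mkℚᵘ (+ n) 0
  toℚᵘ-ℕtoℚ n = Qₚ.toℚᵘ-fromℚᵘ (Qᵘ.mkℚᵘ (+ n) 0)

  ℕtoℚ-+ : ∀ m n → ℕtoℚ (m ℕ.+ n) ≡ ℕtoℚ m + ℕtoℚ n
  ℕtoℚ-+ m n = Qₚ.toℚᵘ-injective
    (Qᵘₚ.≃-trans (toℚᵘ-ℕtoℚ (m ℕ.+ n))
    (Qᵘₚ.≃-trans (Qᵘ.*≡* (cong (ℤ._* + 1) numerators))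
    (Qᵘₚ.≃-sym (Qᵘₚ.≃-trans (Qₚ.toℚᵘ-homo-+ (ℕtoℚ m) (ℕtoℚ n))
                          (Qᵘₚ.+-cong (toℚᵘ-ℕtoℚ m) (toℚᵘ-ℕtoℚ n))))))
    where
    numerators : + (m ℕ.+ n) ≡ + m ℤ.* + 1 ℤ.+ + n ℤ.* + 1
    numerators = trans (ℤₚ.pos-+ m n)
      (sym (cong₂ ℤ._+_ (ℤₚ.*-identityʳ (+ m)) (ℤₚ.*-identityʳ (+ n))))

  ℕtoℚ-* : ∀ m n → ℕtoℚ (m ℕ.* n) ≡ ℕtoℚ m * ℕtoℚ n
  ℕtoℚ-* m n = Qₚ.toℚᵘ-injective
    (Qᵘₚ.≃-trans (toℚᵘ-ℕtoℚ (m ℕ.* n))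
    (Qᵘₚ.≃-trans (Qᵘ.*≡* (cong (ℤ._* + 1) (ℤₚ.pos-* m n)))
    (Qᵘₚ.≃-sym (Qᵘₚ.≃-trans (Qₚ.toℚᵘ-homo-* (ℕtoℚ m) (ℕtoℚ n))
                          (Qᵘₚ.*-cong (toℚᵘ-ℕtoℚ m) (toℚᵘ-ℕtoℚ n))))))

  ℕtoℚ-injective : ∀ m n → ℕtoℚ m ≡ ℕtoℚ n → m ≡ n
  ℕtoℚ-injective m n eq
    with Qᵘₚ.≃-trans (Qᵘₚ.≃-sym (toℚᵘ-ℕtoℚ m)) (Qᵘₚ.≃-trans (Qₚ.toℚᵘ-cong eq) (toℚᵘ-ℕtoℚ n))
  ... | Qᵘ.*≡* cross = ℤₚ.+-injective
    (trans (sym (ℤₚ.*-identityʳ (+ m))) (trans cross (ℤₚ.*-identityʳ (+ n))))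

  ℕtoℚ-suc : ∀ n → ℕtoℚ (suc n) ≡ 1ℚ + ℕtoℚ n
  ℕtoℚ-suc = ℕtoℚ-+ 1

  ℕtoℚ-suc-≢0 : ∀ n → ℕtoℚ (suc n) ≢ 0ℚ
  ℕtoℚ-suc-≢0 n eq with ℕtoℚ-injective (suc n) 0 eq
  ... | ()

  *-≢0 : ∀ {p q} → p ≢ 0ℚ → q ≢ 0ℚ → p * q ≢ 0ℚ
  *-≢0 {p} {q} p≢0 q≢0 pq≡0 = q≢0 (begin
    q                      ≡⟨ sym (Qₚ.*-identityˡ q) ⟩
    1ℚ * q                 ≡⟨ cong (_* q) (sym (Qₚ.*-inverseˡ p)) ⟩
    (Q.1/ p * p) * q       ≡⟨ Qₚ.*-assoc (Q.1/ p) p q ⟩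
    Q.1/ p * (p * q)       ≡⟨ cong (Q.1/ p *_) pq≡0 ⟩
    Q.1/ p * 0ℚ            ≡⟨ Qₚ.*-zeroʳ (Q.1/ p) ⟩
    0ℚ                     ∎)
    where instance _ = Q.≢-nonZero p≢0

  ≢⇒-≢0 : ∀ {p q} → p ≢ q → p + - q ≢ 0ℚ
  ≢⇒-≢0 {p} {q} p≢q = p≢q ∘ x∙y⁻¹≈ε⇒x≈y p q

  powℚ : ℚ → ℕ → ℚ
  powℚ a zero    = 1ℚ
  powℚ a (suc n) = a * powℚ a n

  powℚ-ℕtoℚ : ∀ a n → powℚ (ℕtoℚ a) n ≡ ℕtoℚ (a ℕ.^ n)
  powℚ-ℕtoℚ a zero    = refl
  powℚ-ℕtoℚ a (suc n) =
    trans (cong (ℕtoℚ a *_) (powℚ-ℕtoℚ a n)) (sym (ℕtoℚ-* a (a ℕ.^ n)))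

  powℚ-1 : ∀ n → powℚ 1ℚ n ≡ 1ℚ
  powℚ-1 zero    = refl
  powℚ-1 (suc n) = trans (Qₚ.*-identityˡ _) (powℚ-1 n)

  powℚ-ℕtoℚ-≢1 : ∀ l m → 2 ≤ l → 1 ≤ m → powℚ (ℕtoℚ l) m ≢ 1ℚ
  powℚ-ℕtoℚ-≢1 l m 2≤l 1≤m eq
    with ℕₚ.m^n≡1⇒n≡0∨m≡1 l m (ℕtoℚ-injective (l ℕ.^ m) 1 (trans (sym (powℚ-ℕtoℚ l m)) eq))
  ... | inj₁ m≡0 = ℕₚ.<⇒≢ 1≤m (sym m≡0)
  ... | inj₂ l≡1 = ℕₚ.<⇒≢ 2≤l (sym l≡1)

  scaledPowerDifference-≢0 : ∀ c l m → c ≢ 0ℚ → 2 ≤ l → 1 ≤ m →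
    c * powℚ (ℕtoℚ l) m + - (c * powℚ 1ℚ m) ≢ 0ℚ
  scaledPowerDifference-≢0 c l m c≢0 2≤l 1≤m =
    subst (_≢ 0ℚ) (solve 3 (λ c P R → c :* (P :+ :- R) := c :* P :+ :- (c :* R)) refl c P R)
      (*-≢0 c≢0 (≢⇒-≢0 (subst (P ≢_) (sym (powℚ-1 m)) (powℚ-ℕtoℚ-≢1 l m 2≤l 1≤m))))
    where
    P R : ℚ
    P = powℚ (ℕtoℚ l) m
    R = powℚ 1ℚ m

  addCoeffs : List ℚ → List ℚ → List ℚ
  addCoeffs []      q       = q
  addCoeffs (a ∷ p) []      = a ∷ p
  addCoeffs (a ∷ p) (b ∷ q) = (a + b) ∷ addCoeffs p q

  mulAx+1 : ℚ → List ℚ → List ℚ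
  mulAx+1 a p = addCoeffs p (0ℚ ∷ map (a *_) p)

  substAx+1 : ℚ → List ℚ → List ℚ
  substAx+1 a []       = []
  substAx+1 a (c ∷ cs) = addCoeffs (c ∷ []) (mulAx+1 a (substAx+1 a cs))

  substDifference : ℚ → List ℚ → List ℚ
  substDifference a p = addCoeffs (substAx+1 a p) (map -_ (substAx+1 1ℚ p))

  revCoeffs : ℕ → (ℕ → ℚ) → List ℚ
  revCoeffs zero    g = g 0 ∷ []
  revCoeffs (suc m) g = revCoeffs m (g ∘ suc) ++ g 0 ∷ []

  bernoulliCoeffs : ℕ → List ℚ
  bernoulliCoeffs n = revCoeffs n (λ i → ℕtoℚ (n C i) * bernoulli i)

  length-revCoeffs : ∀ m g → length (revCoeffs m g) ≡ suc m
  length-revCoeffs zero    g = refl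
  length-revCoeffs (suc m) g = begin
    length (revCoeffs m (g ∘ suc) ++ g 0 ∷ [])  ≡⟨ List.length-++ (revCoeffs m (g ∘ suc)) ⟩
    length (revCoeffs m (g ∘ suc)) ℕ.+ 1         ≡⟨ cong (ℕ._+ 1) (length-revCoeffs m (g ∘ suc)) ⟩
    suc m ℕ.+ 1                                  ≡⟨ ℕₚ.+-comm (suc m) 1 ⟩
    suc (suc m)                                  ∎

  length-addCoeffs : ∀ p q → length p ≤ length q → length (addCoeffs p q) ≡ length q
  length-addCoeffs []      q       _         = refl
  length-addCoeffs (a ∷ p) (b ∷ q) (s≤s p≤q) = cong suc (length-addCoeffs p q p≤q)

  addCoeffs-++ : ∀ p q r s → length p ≡ length q →
    addCoeffs (p ++ r) (q ++ s) ≡ addCoeffs p q ++ addCoeffs r s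
  addCoeffs-++ []      []      r s _  = refl
  addCoeffs-++ (a ∷ p) (b ∷ q) r s eq =
    cong ((a + b) ∷_) (addCoeffs-++ p q r s (ℕₚ.suc-injective eq))

  addCoeffs-singleton-++ : ∀ c p q → 1 ≤ length p →
    addCoeffs (c ∷ []) (p ++ q) ≡ addCoeffs (c ∷ []) p ++ q
  addCoeffs-singleton-++ c (a ∷ p) q _ = refl

  mulAx+1-lastTwo : ∀ a q s t → mulAx+1 a (q ++ s ∷ t ∷ []) ≡
    addCoeffs (q ++ s ∷ []) (0ℚ ∷ map (a *_) q) ++ (t + a * s) ∷ a * t ∷ []
  mulAx+1-lastTwo a q s t = begin
    addCoeffs (q ++ s ∷ t ∷ []) (0ℚ ∷ map (a *_) (q ++ s ∷ t ∷ []))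
      ≡⟨ cong₂ addCoeffs (sym (List.++-assoc q (s ∷ []) (t ∷ [])))
                         (cong (0ℚ ∷_) (List.map-++ (a *_) q (s ∷ t ∷ []))) ⟩
    addCoeffs ((q ++ s ∷ []) ++ t ∷ []) ((0ℚ ∷ map (a *_) q) ++ a * s ∷ a * t ∷ [])
      ≡⟨ addCoeffs-++ (q ++ s ∷ []) (0ℚ ∷ map (a *_) q) (t ∷ []) (a * s ∷ a * t ∷ []) lengths ⟩
    addCoeffs (q ++ s ∷ []) (0ℚ ∷ map (a *_) q) ++ (t + a * s) ∷ a * t ∷ []
      ∎
    where
    lengths : length (q ++ s ∷ []) ≡ suc (length (map (a *_) q))
    lengths = trans (List.length-++ q) (trans (ℕₚ.+-comm (length q) 1)
                (cong suc (sym (List.length-map (a *_) q))))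

  -- The closed forms come from p(a x + 1) = Σ cᵢ (a x + 1)ⁱ: only the two
  -- highest powers of (a x + 1) reach the two highest powers of x.
  substAx+1-lastTwo : ∀ a q s t → Σ (List ℚ) λ q′ → length q′ ≡ length q ×
    substAx+1 a (q ++ s ∷ t ∷ []) ≡
      q′ ++ (ℕtoℚ (suc (length q)) * t + s) * powℚ a (length q)
           ∷ t * powℚ a (suc (length q)) ∷ []
  substAx+1-lastTwo a [] s t = [] , refl , cong₂ (λ u v → u ∷ v ∷ [])
    (solve 2 (λ s t → s :+ ((t :+ con 0ℚ) :+ con 0ℚ) := (con 1ℚ :* t :+ s) :* con 1ℚ) refl s t)
    (solve 2 (λ a t → a :* (t :+ con 0ℚ) := t :* (a :* con 1ℚ)) refl a t)
  substAx+1-lastTwo a (c ∷ q) s t with substAx+1-lastTwo a q s t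
  ... | q₀ , |q₀|≡|q| , eq = addCoeffs (c ∷ []) Y , |Y|≡1+|q| , (begin
      addCoeffs (c ∷ []) (mulAx+1 a (substAx+1 a (q ++ s ∷ t ∷ [])))
        ≡⟨ cong (addCoeffs (c ∷ []) ∘ mulAx+1 a) eq ⟩
      addCoeffs (c ∷ []) (mulAx+1 a (q₀ ++ S ∷ T ∷ []))
        ≡⟨ cong (addCoeffs (c ∷ [])) (mulAx+1-lastTwo a q₀ S T) ⟩
      addCoeffs (c ∷ []) (Y ++ (T + a * S) ∷ a * T ∷ [])
        ≡⟨ addCoeffs-singleton-++ c Y _ 1≤|Y| ⟩
      addCoeffs (c ∷ []) Y ++ (T + a * S) ∷ a * T ∷ []
        ≡⟨ cong (λ u → addCoeffs (c ∷ []) Y ++ u ∷ a * T ∷ []) nextS ⟩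
      addCoeffs (c ∷ []) Y ++ S′ ∷ a * T ∷ []
        ≡⟨ cong (λ u → addCoeffs (c ∷ []) Y ++ S′ ∷ u ∷ [])
             (solve 3 (λ a t P → a :* (t :* P) := t :* (a :* P)) refl a t (powℚ a (suc m))) ⟩
      addCoeffs (c ∷ []) Y ++ (ℕtoℚ (suc (suc m)) * t + s) * powℚ a (suc m)
                            ∷ t * powℚ a (suc (suc m)) ∷ []
        ∎)
    where
    m : ℕ
    m = length q
    S T S′ : ℚ
    S = (ℕtoℚ (suc m) * t + s) * powℚ a m
    T = t * powℚ a (suc m)
    S′ = (ℕtoℚ (suc (suc m)) * t + s) * powℚ a (suc m)
    Y : List ℚ
    Y = addCoeffs (q₀ ++ S ∷ []) (0ℚ ∷ map (a *_) q₀)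
    |Y| : length Y ≡ suc m
    |Y| = trans (length-addCoeffs (q₀ ++ S ∷ []) (0ℚ ∷ map (a *_) q₀)
                   (ℕₚ.≤-reflexive (trans (List.length-++ q₀) (trans (ℕₚ.+-comm (length q₀) 1)
                      (cong suc (sym (List.length-map (a *_) q₀)))))))
                (cong suc (trans (List.length-map (a *_) q₀) |q₀|≡|q|))
    1≤|Y| : 1 ≤ length Y
    1≤|Y| = subst (1 ≤_) (sym |Y|) (s≤s z≤n)
    |Y|≡1+|q| : length (addCoeffs (c ∷ []) Y) ≡ suc m
    |Y|≡1+|q| = trans (length-addCoeffs (c ∷ []) Y 1≤|Y|) |Y|
    nextS : T + a * S ≡ S′
    nextS = begin
      T + a * S
        ≡⟨ solve 5 (λ a t s N P → t :* (a :* P) :+ a :* ((N :* t :+ s) :* P)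
                                := ((con 1ℚ :+ N) :* t :+ s) :* (a :* P))
                   refl a t s (ℕtoℚ (suc m)) (powℚ a m) ⟩
      ((1ℚ + ℕtoℚ (suc m)) * t + s) * powℚ a (suc m)
        ≡⟨ cong (λ N → (N * t + s) * powℚ a (suc m)) (sym (ℕtoℚ-suc (suc m))) ⟩
      (ℕtoℚ (suc (suc m)) * t + s) * powℚ a (suc m)
        ∎

  substDifference-lastTwo : ∀ a q s t →
    let m = length q
        c = ℕtoℚ (suc m) * t + s
    in Σ (List ℚ) λ front →
       substDifference a (q ++ s ∷ t ∷ []) ≡
         front ++ (c * powℚ a m + - (c * powℚ 1ℚ m))
              ∷ (t * powℚ a (suc m) + - (t * powℚ 1ℚ (suc m))) ∷ []
  substDifference-lastTwo a q s t
    with substAx+1-lastTwo a q s t | substAx+1-lastTwo 1ℚ q s t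
  ... | qₐ , |qₐ| , eqₐ | q₁ , |q₁| , eq₁ = addCoeffs qₐ (map -_ q₁) , (begin
    addCoeffs (substAx+1 a (q ++ s ∷ t ∷ [])) (map -_ (substAx+1 1ℚ (q ++ s ∷ t ∷ [])))
      ≡⟨ cong₂ (λ u v → addCoeffs u (map -_ v)) eqₐ eq₁ ⟩
    addCoeffs (qₐ ++ Sₐ ∷ Tₐ ∷ []) (map -_ (q₁ ++ S₁ ∷ T₁ ∷ []))
      ≡⟨ cong (addCoeffs (qₐ ++ Sₐ ∷ Tₐ ∷ [])) (List.map-++ -_ q₁ (S₁ ∷ T₁ ∷ [])) ⟩
    addCoeffs (qₐ ++ Sₐ ∷ Tₐ ∷ []) (map -_ q₁ ++ - S₁ ∷ - T₁ ∷ [])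
      ≡⟨ addCoeffs-++ qₐ (map -_ q₁) (Sₐ ∷ Tₐ ∷ []) (- S₁ ∷ - T₁ ∷ [])
           (trans |qₐ| (sym (trans (List.length-map -_ q₁) |q₁|))) ⟩
    addCoeffs qₐ (map -_ q₁) ++ (Sₐ + - S₁) ∷ (Tₐ + - T₁) ∷ []
      ∎)
    where
    m : ℕ
    m = length q
    c Sₐ Tₐ S₁ T₁ : ℚ
    c = ℕtoℚ (suc m) * t + s
    Sₐ = c * powℚ a m
    Tₐ = t * powℚ a (suc m)
    S₁ = c * powℚ 1ℚ m
    T₁ = t * powℚ 1ℚ (suc m)

  bernoulliDifference-lastTwo : ∀ k l → 2 ≤ l →
    Σ (List ℚ) λ front → Σ ℚ λ v → Σ ℚ λ w →
      substDifference (ℕtoℚ l) (bernoulliCoeffs (suc (suc k))) ≡ front ++ v ∷ w ∷ [] ×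
      v ≢ 0ℚ × w ≢ 0ℚ
  bernoulliDifference-lastTwo k l 2≤l =
    proj₁ lastTwo , v , w , trans (cong (substDifference (ℕtoℚ l)) split) (proj₂ lastTwo) ,
      scaledPowerDifference-≢0 c l m c≢0 2≤l (subst (1 ≤_) (sym |q|) (s≤s z≤n)) ,
      scaledPowerDifference-≢0 1ℚ l (suc m) (λ ()) 2≤l (s≤s z≤n)
    where
    n m : ℕ
    n = suc (suc k)
    q : List ℚ
    q = revCoeffs k (λ i → ℕtoℚ (n C suc (suc i)) * bernoulli (suc (suc i)))
    m = length q
    s c v w : ℚ
    s = ℕtoℚ (n C 1) * bernoulli 1
    c = ℕtoℚ (suc m) * 1ℚ + s
    v = c * powℚ (ℕtoℚ l) m + - (c * powℚ 1ℚ m)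
    w = 1ℚ * powℚ (ℕtoℚ l) (suc m) + - (1ℚ * powℚ 1ℚ (suc m))
    |q| : m ≡ suc k
    |q| = length-revCoeffs k _
    -- the leading coefficient C(n,0) B₀ computes to 1ℚ
    split : bernoulliCoeffs n ≡ q ++ s ∷ 1ℚ ∷ []
    split = List.++-assoc q (s ∷ []) (1ℚ ∷ [])
    lastTwo : Σ (List ℚ) λ front →
      substDifference (ℕtoℚ l) (q ++ s ∷ 1ℚ ∷ []) ≡ front ++ v ∷ w ∷ []
    lastTwo = substDifference-lastTwo (ℕtoℚ l) q s 1ℚ
    -- B₁ = -1/2 makes the coefficient n + n B₁ of xⁿ⁻¹ in Bₙ(x + 1) equal to n/2
    c≢0 : c ≢ 0ℚ
    c≢0 = subst (_≢ 0ℚ) (sym c≡n/2) (*-≢0 (ℕtoℚ-suc-≢0 (suc k)) (λ ()))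
      where
      c≡n/2 : c ≡ ℕtoℚ n * ½
      c≡n/2 = begin
        ℕtoℚ (suc m) * 1ℚ + ℕtoℚ (n C 1) * bernoulli 1
          ≡⟨ cong₂ (λ u v → ℕtoℚ u * 1ℚ + ℕtoℚ v * bernoulli 1) (cong suc |q|) (nC1≡n n) ⟩
        ℕtoℚ n * 1ℚ + ℕtoℚ n * bernoulli 1
          ≡⟨ solve 2 (λ N b → N :* con 1ℚ :+ N :* b := N :* (con 1ℚ :+ b))
                   refl (ℕtoℚ n) (bernoulli 1) ⟩
        ℕtoℚ n * ½
          ∎

open RationalPolynomials

module Evaluation {c ℓ : Level} (K : AlgClosedFieldOverℚ c ℓ) where
  open AlgClosedFieldOverℚ K
  open CommutativeRing K-ring
  open Poly K-ring
  open import Relation.Binary.Reasoning.Setoid setoid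
  open import Algebra.Properties.Group +-group using (inverseʳ-unique; ε⁻¹≈ε)
  open import Algebra.Properties.AbelianGroup +-abelianGroup using (⁻¹-∙-comm)
  open import Algebra.Properties.Ring ring using (-‿distribʳ-*)
  open import Tactic.RingSolver.Core.AlmostCommutativeRing using (fromCommutativeRing)
  open import Tactic.RingSolver.NonReflective (fromCommutativeRing K-ring (λ _ → nothing))
    using (solve; _⊜_; _⊕_; _⊗_)

  ι-0 : ι 0ℚ ≈ 0#
  ι-0 = begin
    ι 0ℚ                    ≈⟨ +-identityʳ _ ⟨
    ι 0ℚ + 0#               ≈⟨ +-congˡ (-‿inverseʳ (ι 0ℚ)) ⟨
    ι 0ℚ + (ι 0ℚ - ι 0ℚ)    ≈⟨ +-assoc _ _ _ ⟨
    (ι 0ℚ + ι 0ℚ) - ι 0ℚ    ≈⟨ +-congʳ (ι-+ 0ℚ 0ℚ) ⟨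
    ι 0ℚ - ι 0ℚ             ≈⟨ -‿inverseʳ _ ⟩
    0#                      ∎

  ι-neg : ∀ q → ι (Q.- q) ≈ - ι q
  ι-neg q = inverseʳ-unique (ι q) (ι (Q.- q))
    (trans (sym (ι-+ q (Q.- q))) (trans (reflexive (≡.cong ι (Qₚ.+-inverseʳ q))) ι-0))

  ι-≉0 : ∀ q → q ≢ 0ℚ → ¬ (ι q ≈ 0#)
  ι-≉0 q q≢0 ιq≈0 = 1≉0 (begin
    1#                      ≈⟨ ι-1 ⟨
    ι 1ℚ                    ≡⟨ ≡.cong ι (≡.sym (Qₚ.*-inverseʳ q)) ⟩
    ι (q Q.* Q.1/ q)        ≈⟨ ι-* q (Q.1/ q) ⟩
    ι q * ι (Q.1/ q)        ≈⟨ *-congʳ ιq≈0 ⟩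
    0# * ι (Q.1/ q)         ≈⟨ zeroˡ _ ⟩
    0#                      ∎)
    where instance _ = Q.≢-nonZero q≢0

  ⟦_⟧ : List ℚ → Carrier → Carrier
  ⟦ p ⟧ x = evalList (map ι p) x

  evalList-cong : ∀ as {x y} → x ≈ y → evalList as x ≈ evalList as y
  evalList-cong []       x≈y = refl
  evalList-cong (a ∷ as) x≈y = +-congˡ (*-cong x≈y (evalList-cong as x≈y))

  evalList-++ : ∀ as bs x →
    evalList (as ++ bs) x ≈ evalList as x + pow x (length as) * evalList bs x
  evalList-++ []       bs x = sym (trans (+-identityˡ _) (*-identityˡ _))
  evalList-++ (a ∷ as) bs x = trans (+-congˡ (*-congˡ (evalList-++ as bs x)))
    (solve 5 (λ a x E B P → (a ⊕ x ⊗ (E ⊕ P ⊗ B)) ⊜ ((a ⊕ x ⊗ E) ⊕ (x ⊗ P) ⊗ B)) refl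
       a x (evalList as x) (evalList bs x) (pow x (length as)))

  ⟦⟧-++ : ∀ p q x → ⟦ p ++ q ⟧ x ≈ ⟦ p ⟧ x + pow x (length p) * ⟦ q ⟧ x
  ⟦⟧-++ p q x = begin
    ⟦ p ++ q ⟧ x
      ≡⟨ ≡.cong (λ r → evalList r x) (List.map-++ ι p q) ⟩
    evalList (map ι p ++ map ι q) x
      ≈⟨ evalList-++ (map ι p) (map ι q) x ⟩
    ⟦ p ⟧ x + pow x (length (map ι p)) * ⟦ q ⟧ x
      ≡⟨ ≡.cong (λ k → ⟦ p ⟧ x + pow x k * ⟦ q ⟧ x) (List.length-map ι p) ⟩
    ⟦ p ⟧ x + pow x (length p) * ⟦ q ⟧ x
      ∎

  ⟦⟧-addCoeffs : ∀ p q x → ⟦ addCoeffs p q ⟧ x ≈ ⟦ p ⟧ x + ⟦ q ⟧ x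
  ⟦⟧-addCoeffs []      q       x = sym (+-identityˡ _)
  ⟦⟧-addCoeffs (a ∷ p) []      x = sym (+-identityʳ _)
  ⟦⟧-addCoeffs (a ∷ p) (b ∷ q) x = trans (+-cong (ι-+ a b) (*-congˡ (⟦⟧-addCoeffs p q x)))
    (solve 5 (λ a b x E F → ((a ⊕ b) ⊕ x ⊗ (E ⊕ F)) ⊜ ((a ⊕ x ⊗ E) ⊕ (b ⊕ x ⊗ F))) refl
       (ι a) (ι b) x (⟦ p ⟧ x) (⟦ q ⟧ x))

  ⟦⟧-neg : ∀ p x → ⟦ map Q.-_ p ⟧ x ≈ - ⟦ p ⟧ x
  ⟦⟧-neg []      x = sym ε⁻¹≈ε
  ⟦⟧-neg (a ∷ p) x = trans (+-cong (ι-neg a) (*-congˡ (⟦⟧-neg p x)))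
    (trans (+-congˡ (sym (-‿distribʳ-* x (⟦ p ⟧ x)))) (⁻¹-∙-comm (ι a) (x * ⟦ p ⟧ x)))

  ⟦⟧-scale : ∀ a p x → ⟦ map (a Q.*_) p ⟧ x ≈ ι a * ⟦ p ⟧ x
  ⟦⟧-scale a []      x = sym (zeroʳ _)
  ⟦⟧-scale a (c ∷ p) x = trans (+-cong (ι-* a c) (*-congˡ (⟦⟧-scale a p x)))
    (solve 4 (λ a c x E → ((a ⊗ c) ⊕ x ⊗ (a ⊗ E)) ⊜ (a ⊗ (c ⊕ x ⊗ E))) refl (ι a) (ι c) x (⟦ p ⟧ x))

  ⟦⟧-mulAx+1 : ∀ a p x → ⟦ mulAx+1 a p ⟧ x ≈ (ι a * x + 1#) * ⟦ p ⟧ x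
  ⟦⟧-mulAx+1 a p x = begin
    ⟦ mulAx+1 a p ⟧ x
      ≈⟨ ⟦⟧-addCoeffs p (0ℚ ∷ map (a Q.*_) p) x ⟩
    ⟦ p ⟧ x + (ι 0ℚ + x * ⟦ map (a Q.*_) p ⟧ x)
      ≈⟨ +-congˡ (+-cong ι-0 (*-congˡ (⟦⟧-scale a p x))) ⟩
    ⟦ p ⟧ x + (0# + x * (ι a * ⟦ p ⟧ x))
      ≈⟨ +-congˡ (+-identityˡ _) ⟩
    ⟦ p ⟧ x + x * (ι a * ⟦ p ⟧ x)
      ≈⟨ +-congˡ (trans (sym (*-assoc _ _ _)) (*-congʳ (*-comm x (ι a)))) ⟩
    ⟦ p ⟧ x + (ι a * x) * ⟦ p ⟧ x
      ≈⟨ +-comm _ _ ⟩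
    (ι a * x) * ⟦ p ⟧ x + ⟦ p ⟧ x
      ≈⟨ +-congˡ (*-identityˡ _) ⟨
    (ι a * x) * ⟦ p ⟧ x + 1# * ⟦ p ⟧ x
      ≈⟨ distribʳ _ _ _ ⟨
    (ι a * x + 1#) * ⟦ p ⟧ x
      ∎

  ⟦⟧-substAx+1 : ∀ a p x → ⟦ substAx+1 a p ⟧ x ≈ ⟦ p ⟧ (ι a * x + 1#)
  ⟦⟧-substAx+1 a []       x = refl
  ⟦⟧-substAx+1 a (c ∷ cs) x = begin
    ⟦ addCoeffs (c ∷ []) (mulAx+1 a (substAx+1 a cs)) ⟧ x
      ≈⟨ ⟦⟧-addCoeffs (c ∷ []) (mulAx+1 a (substAx+1 a cs)) x ⟩
    (ι c + x * 0#) + ⟦ mulAx+1 a (substAx+1 a cs) ⟧ x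
      ≈⟨ +-cong (trans (+-congˡ (zeroʳ x)) (+-identityʳ _)) (⟦⟧-mulAx+1 a (substAx+1 a cs) x) ⟩
    ι c + (ι a * x + 1#) * ⟦ substAx+1 a cs ⟧ x
      ≈⟨ +-congˡ (*-congˡ (⟦⟧-substAx+1 a cs x)) ⟩
    ι c + (ι a * x + 1#) * ⟦ cs ⟧ (ι a * x + 1#)
      ∎

  ⟦⟧-substDifference : ∀ a p x →
    ⟦ substDifference a p ⟧ x ≈ ⟦ p ⟧ (ι a * x + 1#) - ⟦ p ⟧ (x + 1#)
  ⟦⟧-substDifference a p x = begin
    ⟦ substDifference a p ⟧ x
      ≈⟨ ⟦⟧-addCoeffs (substAx+1 a p) (map Q.-_ (substAx+1 1ℚ p)) x ⟩
    ⟦ substAx+1 a p ⟧ x + ⟦ map Q.-_ (substAx+1 1ℚ p) ⟧ x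
      ≈⟨ +-cong (⟦⟧-substAx+1 a p x)
                (trans (⟦⟧-neg (substAx+1 1ℚ p) x) (-‿cong (⟦⟧-substAx+1 1ℚ p x))) ⟩
    ⟦ p ⟧ (ι a * x + 1#) - ⟦ p ⟧ (ι 1ℚ * x + 1#)
      ≈⟨ +-congˡ (-‿cong (evalList-cong (map ι p)
                                        (+-congʳ (trans (*-congʳ ι-1) (*-identityˡ x))))) ⟩
    ⟦ p ⟧ (ι a * x + 1#) - ⟦ p ⟧ (x + 1#)
      ∎

  sumUpTo : ℕ → (ℕ → Carrier) → Carrier
  sumUpTo zero    f = 0#
  sumUpTo (suc n) f = f 0 + sumUpTo n (f ∘ suc)

  foldr-applyUpTo : ∀ n (f : ℕ → Carrier) h →
    foldr (λ i s → f i + s) 0# (applyUpTo h n) ≡ sumUpTo n (f ∘ h)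
  foldr-applyUpTo zero    f h = ≡.refl
  foldr-applyUpTo (suc n) f h = ≡.cong (λ s → f (h 0) + s) (foldr-applyUpTo n f (h ∘ suc))

  ⟦⟧-revCoeffs : ∀ m g t → ⟦ revCoeffs m g ⟧ t ≈ sumUpTo (suc m) (λ i → ι (g i) * pow t (m ∸ i))
  ⟦⟧-revCoeffs zero    g t = begin
    ι (g 0) + t * 0#         ≈⟨ trans (+-congˡ (zeroʳ t)) (+-identityʳ _) ⟩
    ι (g 0)                  ≈⟨ trans (+-identityʳ _) (*-identityʳ _) ⟨
    ι (g 0) * 1# + 0#        ∎
  ⟦⟧-revCoeffs (suc m) g t = begin
    ⟦ revCoeffs m (g ∘ suc) ++ g 0 ∷ [] ⟧ t
      ≈⟨ ⟦⟧-++ (revCoeffs m (g ∘ suc)) (g 0 ∷ []) t ⟩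
    ⟦ revCoeffs m (g ∘ suc) ⟧ t + pow t (length (revCoeffs m (g ∘ suc))) * (ι (g 0) + t * 0#)
      ≈⟨ +-cong (⟦⟧-revCoeffs m (g ∘ suc) t)
                (*-cong (reflexive (≡.cong (pow t) (length-revCoeffs m (g ∘ suc))))
                        (trans (+-congˡ (zeroʳ t)) (+-identityʳ _))) ⟩
    sumUpTo (suc m) (λ i → ι (g (suc i)) * pow t (m ∸ i)) + pow t (suc m) * ι (g 0)
      ≈⟨ trans (+-comm _ _) (+-congʳ (*-comm _ _)) ⟩
    ι (g 0) * pow t (suc m) + sumUpTo (suc m) (λ i → ι (g (suc i)) * pow t (m ∸ i))
      ∎

  bernoulliPoly≈⟦bernoulliCoeffs⟧ : ∀ n t → bernoulliPoly n t ≈ ⟦ bernoulliCoeffs n ⟧ t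
  bernoulliPoly≈⟦bernoulliCoeffs⟧ n t = begin
    bernoulliPoly n t                                   ≡⟨ foldr-applyUpTo (suc n) f (λ i → i) ⟩
    sumUpTo (suc n) f                                   ≈⟨ ⟦⟧-revCoeffs n b t ⟨
    ⟦ bernoulliCoeffs n ⟧ t                             ∎
    where
    b : ℕ → ℚ
    b i = ℕtoℚ (n C i) Q.* bernoulli i
    f : ℕ → Carrier
    f i = ι (b i) * pow t (n ∸ i)

  G≈⟦substDifference⟧ : ∀ k l x →
    G k l x ≈ ι ((+ 1) Q./ suc k) * ⟦ substDifference (ℕtoℚ l) (bernoulliCoeffs (suc k)) ⟧ x
  G≈⟦substDifference⟧ k l x = *-congˡ (begin
    bernoulliPoly (suc k) (ι (ℕtoℚ l) * x + 1#) - bernoulliPoly (suc k) (x + 1#)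
      ≈⟨ +-cong (bernoulliPoly≈⟦bernoulliCoeffs⟧ (suc k) _)
                (-‿cong (bernoulliPoly≈⟦bernoulliCoeffs⟧ (suc k) _)) ⟩
    ⟦ bernoulliCoeffs (suc k) ⟧ (ι (ℕtoℚ l) * x + 1#) - ⟦ bernoulliCoeffs (suc k) ⟧ (x + 1#)
      ≈⟨ ⟦⟧-substDifference (ℕtoℚ l) (bernoulliCoeffs (suc k)) x ⟨
    ⟦ substDifference (ℕtoℚ l) (bernoulliCoeffs (suc k)) ⟧ x
      ∎)

  G-zero : ∀ k l → G k l 0# ≈ 0#
  G-zero k l = begin
    G k l 0#                                 ≈⟨ G≈⟦substDifference⟧ k l 0# ⟩
    ι (+ 1 Q./ suc k) * ⟦ substDifference L B ⟧ 0#
      ≈⟨ *-congˡ (⟦⟧-substDifference L B 0#) ⟩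
    ι (+ 1 Q./ suc k) * (⟦ B ⟧ (ι L * 0# + 1#) - ⟦ B ⟧ (0# + 1#))
      ≈⟨ *-congˡ (+-congʳ (evalList-cong (map ι B) (+-congʳ (zeroʳ (ι L))))) ⟩
    ι (+ 1 Q./ suc k) * (⟦ B ⟧ (0# + 1#) - ⟦ B ⟧ (0# + 1#))
      ≈⟨ trans (*-congˡ (-‿inverseʳ _)) (zeroʳ _) ⟩
    0#                                       ∎
    where
    L : ℚ
    L = ℕtoℚ l
    B : List ℚ
    B = bernoulliCoeffs (suc k)

  nonzeroRoot-constant≢0 : ∀ a as b → a ≢ 0ℚ → b ≢ 0ℚ →
    Σ Carrier λ y → ¬ (y ≈ 0#) × ⟦ a ∷ as ++ b ∷ [] ⟧ y ≈ 0#
  nonzeroRoot-constant≢0 a as b a≢0 b≢0 = y , y≉0 , root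
    where
    closedRoot : Σ Carrier λ y → evalList (map ι (a ∷ as) ++ ι b ∷ []) y ≈ 0#
    closedRoot = closed (map ι (a ∷ as)) (ι b) (s≤s z≤n) (ι-≉0 b b≢0)
    y : Carrier
    y = proj₁ closedRoot
    root : ⟦ a ∷ as ++ b ∷ [] ⟧ y ≈ 0#
    root = trans (reflexive (≡.cong (λ r → evalList r y) (List.map-++ ι (a ∷ as) (b ∷ []))))
                 (proj₂ closedRoot)
    y≉0 : ¬ (y ≈ 0#)
    y≉0 y≈0 = ι-≉0 a a≢0 (begin
      ι a                                ≈⟨ +-identityʳ _ ⟨
      ι a + 0#                           ≈⟨ +-congˡ (zeroˡ _) ⟨
      ι a + 0# * ⟦ as ++ b ∷ [] ⟧ y      ≈⟨ +-congˡ (*-congʳ y≈0) ⟨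
      ι a + y * ⟦ as ++ b ∷ [] ⟧ y       ≈⟨ root ⟩
      0#                                 ∎)

  -- Dividing out the largest power of x leaves a polynomial of degree ≥ 1
  -- with nonzero constant term; the roots of that one are nonzero.
  nonzeroRoot : ∀ p v w → v ≢ 0ℚ → w ≢ 0ℚ →
    Σ Carrier λ y → ¬ (y ≈ 0#) × ⟦ p ++ v ∷ w ∷ [] ⟧ y ≈ 0#
  nonzeroRoot []      v w v≢0 w≢0 = nonzeroRoot-constant≢0 v [] w v≢0 w≢0
  nonzeroRoot (a ∷ p) v w v≢0 w≢0 with a Q.≟ 0ℚ
  ... | yes ≡.refl with nonzeroRoot p v w v≢0 w≢0
  ...   | y , y≉0 , root = y , y≉0 , (begin
    ι 0ℚ + y * ⟦ p ++ v ∷ w ∷ [] ⟧ y     ≈⟨ +-cong ι-0 (*-congˡ root) ⟩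
    0# + y * 0#                          ≈⟨ trans (+-identityˡ _) (zeroʳ y) ⟩
    0#                                   ∎)
  nonzeroRoot (a ∷ p) v w v≢0 w≢0 | no a≢0 with nonzeroRoot-constant≢0 a (p ++ v ∷ []) w a≢0 w≢0
  ...   | y , y≉0 , root = y , y≉0 ,
    trans (reflexive (≡.cong (λ r → ⟦ a ∷ r ⟧ y) (≡.sym (List.++-assoc p (v ∷ []) (w ∷ []))))) root

  G-nonzeroRoot : ∀ k l → 1 ≤ k → 2 ≤ l → Σ Carrier λ y → ¬ (y ≈ 0#) × G k l y ≈ 0#
  G-nonzeroRoot (suc k) l _ 2≤l =
    let p , v , w , H≡p++vw , v≢0 , w≢0 = bernoulliDifference-lastTwo k l 2≤l
        y , y≉0 , root = nonzeroRoot p v w v≢0 w≢0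
        c₀ = ι (+ 1 Q./ suc (suc k))
    in y , y≉0 , (begin
      G (suc k) l y
        ≈⟨ G≈⟦substDifference⟧ (suc k) l y ⟩
      c₀ * ⟦ substDifference (ℕtoℚ l) (bernoulliCoeffs (suc (suc k))) ⟧ y
        ≡⟨ ≡.cong (λ r → c₀ * ⟦ r ⟧ y) H≡p++vw ⟩
      c₀ * ⟦ p ++ v ∷ w ∷ [] ⟧ y
        ≈⟨ trans (*-congˡ root) (zeroʳ c₀) ⟩
      0#
        ∎)

lemma4 : ∀ {c ℓ : Level} (k l : ℕ) → 1 ≤ k → 2 ≤ l →
         (K : AlgClosedFieldOverℚ c ℓ) →
         let open AlgClosedFieldOverℚ K
             open CommutativeRing K-ring
         in Σ Carrier λ x → Σ Carrier λ y →
              ¬ (x ≈ y) × (G k l x ≈ 0#) × (G k l y ≈ 0#)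
lemma4 k l 1≤k 2≤l K =
  let open CommutativeRing (AlgClosedFieldOverℚ.K-ring K)
      open Evaluation K
      y , y≉0 , Gy≈0 = G-nonzeroRoot k l 1≤k 2≤l
  in 0# , y , y≉0 ∘ sym , G-zero k l , Gy≈0
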